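{- Let $N,n<\omega$, let $B$ be a contact algebra, $\overline a\in\mathcal K^n(B)$, and let $f\colon N\to n$ be a surjection induced by some covering walk $w$ of the graph $N^1(\overline a)$. If $\overline c\in\mathcal K^N(B)$ is a chain, then $N^1(\overline a)=N^1(f^*\overline c)$.
   Context: A contact algebra is a Boolean algebra with a symmetric relation $\delta$ such that $0$ is related to nothing, $a\,\delta\,a$ for $a\neq0$, and $x\,\delta\,(y\vee z)\iff x\,\delta\,y$ or $x\,\delta\,z$. $\mathcal K^k(B)$ is the set of injective $k$-tuples whose entries form a finite set $C$ with $\bigvee C=1$, distinct members meeting in $0$, and no member strictly below another. $N^1(\overline a)$ is the graph on $\{0,\dots,k-1\}$ with an edge $\{i,j\}$ ($i=j$ allowed) iff $a_i\,\delta\,a_j$. A tuple $\overline c\in\mathcal K^N(B)$ is a chain if for all $i,j<N$: $c_i\,\delta\,c_j\iff|i-j|\le1$. A covering walk of a finite graph $G$ with vertex set $n$ is a walk (a sequence of vertices $w_0,\dots,w_{N-1}$ with consecutive vertices adjacent) visiting each vertex and each edge of $G$ at least once; the surjection $f\colon N\to n$ induced by $w$ is $f(\beta)=w_\beta$. For $\overline c\in\mathcal K^N(B)$ and a surjection $f\colon N\to n$, $f^*\overline c$ is the $n$-tuple with $(f^*\overline c)_i=\bigvee_{j\in f^{ -1}(i)}c_j$. -}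

module Defs where

open import Level using (Level; _⊔_) renaming (suc to lsuc)
open import Data.Nat using (ℕ; zero; suc; _≤_; ∣_-_∣)
open import Data.Fin using (Fin; toℕ) renaming (zero to fzero; suc to fsuc)
open import Data.Fin.Properties using (_≟_)
open import Data.Product using (Σ; _×_; _,_; ∃)
open import Data.Sum using (_⊎_)
open import Data.Bool using (if_then_else_)
open import Relation.Nullary using (¬_; ⌊_⌋)
open import Relation.Binary using (Rel)
open import Relation.Binary.PropositionalEquality using (_≡_)
open import Function.Bundles using (_⇔_)
open import Algebra.Lattice.Bundles using (BooleanAlgebra)

record ContactAlgebra (c ℓ r : Level) : Set (lsuc (c ⊔ ℓ ⊔ r)) where
  field
    booleanAlgebra : BooleanAlgebra c ℓ
  open BooleanAlgebra booleanAlgebra public renaming (¬_ to compl)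
  field
    δ        : Rel Carrier r
    δ-resp   : ∀ {x x′ y y′} → x ≈ x′ → y ≈ y′ → δ x y → δ x′ y′
    δ-sym    : ∀ {x y} → δ x y → δ y x
    δ-⊥      : ∀ x → ¬ δ ⊥ x
    δ-refl   : ∀ x → ¬ (x ≈ ⊥) → δ x x
    δ-∨      : ∀ x y z → (δ x (y ∨ z) ⇔ (δ x y ⊎ δ x z))

-- A finite graph on vertex set Fin n, given by its (symmetric) adjacency
-- relation; loops (i = j) are allowed.
Graph : (n : ℕ) → (ℓ : Level) → Set (lsuc ℓ)
Graph n ℓ = Fin n → Fin n → Set ℓ

Consecutive : ∀ {N} → Fin N → Fin N → Set
Consecutive β β′ = toℕ β′ ≡ suc (toℕ β)

record IsCoveringWalk {ℓ} {n : ℕ} (G : Graph n ℓ) (N : ℕ) (w : Fin N → Fin n) : Set ℓ where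
  field
    isWalk        : ∀ β β′ → Consecutive β β′ → G (w β) (w β′)
    visitsVertices : ∀ i → ∃ λ β → w β ≡ i
    visitsEdges    : ∀ i j → G i j →
                     ∃ λ β → ∃ λ β′ → Consecutive β β′ ×
                       ((w β ≡ i × w β′ ≡ j) ⊎ (w β ≡ j × w β′ ≡ i))

module _ {c ℓ r : Level} (B : ContactAlgebra c ℓ r) where
  open ContactAlgebra B

  _≤B_ : Carrier → Carrier → Set ℓ
  a ≤B b = (a ∧ b) ≈ a

  _<B_ : Carrier → Carrier → Set ℓ
  a <B b = (a ≤B b) × ¬ (a ≈ b)

  ⋁ : ∀ {N} → (Fin N → Carrier) → Carrier
  ⋁ {zero}  g = ⊥
  ⋁ {suc N} g = g fzero ∨ ⋁ (λ j → g (fsuc j))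

  record 𝒦 (k : ℕ) (a : Fin k → Carrier) : Set (c ⊔ ℓ) where
    field
      injective  : ∀ i j → a i ≈ a j → i ≡ j
      joinTop    : ⋁ a ≈ ⊤
      disjoint   : ∀ i j → ¬ (i ≡ j) → (a i ∧ a j) ≈ ⊥
      antichain  : ∀ i j → ¬ (a i <B a j)

  N¹ : ∀ {k} → (Fin k → Carrier) → Graph k r
  N¹ a i j = δ (a i) (a j)

  IsChain : ∀ {N} → (Fin N → Carrier) → Set r
  IsChain c′ = ∀ i j → (δ (c′ i) (c′ j) ⇔ (∣ toℕ i - toℕ j ∣ ≤ 1))

  -- f* c̄ : (f* c̄)_i = ⋁_{j ∈ f⁻¹(i)} c_j
  _* : ∀ {N n} → (Fin N → Fin n) → (Fin N → Carrier) → (Fin n → Carrier)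
  (f *) c′ i = ⋁ (λ j → if ⌊ f j ≟ i ⌋ then c′ j else ⊥)

  SameGraph : ∀ {k} → Graph k r → Graph k r → Set r
  SameGraph G H = ∀ i j → (G i j ⇔ H i j)

-- Since δ distributes over
-- finite joins, (f* c̄)_i δ (f* c̄)_j holds iff c_β δ c_β′ for some β ∈ f⁻¹(i),
-- β′ ∈ f⁻¹(j).  In a chain this means |β − β′| ≤ 1: if β and β′ are
-- consecutive, {f β, f β′} is a step of the walk, hence an edge of N¹(ā);
-- if β = β′, then i = j and a_i δ a_i because members of 𝒦 are nonzero.
-- Conversely every edge of N¹(ā) is traversed by the walk at some pair of
-- consecutive positions, whose chain members are in contact.
module Submission where

open import Defs
open import Level using (Level)
open import Data.Nat using (ℕ; zero; suc; _≤_; z≤n; s≤s; ∣_-_∣)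
open import Data.Fin using (Fin; toℕ) renaming (zero to fzero; suc to fsuc)
open import Data.Fin.Properties using (_≟_; toℕ-injective)
open import Data.Product using (_×_; _,_; ∃; ∃₂)
open import Data.Sum using (_⊎_; inj₁; inj₂)
open import Data.Empty using (⊥-elim)
open import Data.Bool using (if_then_else_)
open import Relation.Nullary using (¬_; yes; no; ⌊_⌋)
open import Relation.Binary.PropositionalEquality using (_≡_; refl; sym; subst)
open import Function.Bundles using (_⇔_; mk⇔; Equivalence)
import Algebra.Lattice.Properties.BooleanAlgebra as BooleanAlgebraProperties

∣m-1+m∣≤1 : ∀ m → ∣ m - suc m ∣ ≤ 1
∣m-1+m∣≤1 zero    = s≤s z≤n
∣m-1+m∣≤1 (suc m) = ∣m-1+m∣≤1 m

∣m-n∣≤1⇒m≡n⊎adjacent : ∀ m n → ∣ m - n ∣ ≤ 1 → m ≡ n ⊎ n ≡ suc m ⊎ m ≡ suc n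
∣m-n∣≤1⇒m≡n⊎adjacent zero          zero          _        = inj₁ refl
∣m-n∣≤1⇒m≡n⊎adjacent zero          (suc zero)    _        = inj₂ (inj₁ refl)
∣m-n∣≤1⇒m≡n⊎adjacent (suc zero)    zero          _        = inj₂ (inj₂ refl)
∣m-n∣≤1⇒m≡n⊎adjacent zero          (suc (suc n)) (s≤s ())
∣m-n∣≤1⇒m≡n⊎adjacent (suc (suc m)) zero          (s≤s ())
∣m-n∣≤1⇒m≡n⊎adjacent (suc m)       (suc n)       p with ∣m-n∣≤1⇒m≡n⊎adjacent m n p
... | inj₁ refl        = inj₁ refl
... | inj₂ (inj₁ refl) = inj₂ (inj₁ refl)
... | inj₂ (inj₂ refl) = inj₂ (inj₂ refl)

module _ {c ℓ r : Level} (B : ContactAlgebra c ℓ r) where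
  open ContactAlgebra B renaming (refl to ≈-refl; sym to ≈-sym)
  open BooleanAlgebraProperties booleanAlgebra using (∧-zeroˡ; ∧-zeroʳ; ∧-identityʳ; ∨-identityʳ)
  open import Relation.Binary.Reasoning.Setoid setoid

  δ-⋁ : ∀ {N} x (g : Fin N → Carrier) → δ x (⋁ B g) ⇔ ∃ λ β → δ x (g β)
  δ-⋁ {zero}  x g = mk⇔ (λ d → ⊥-elim (δ-⊥ x (δ-sym d))) (λ { (() , _) })
  δ-⋁ {suc N} x g = mk⇔ to from
    where
    head∨tail = δ-∨ x (g fzero) (⋁ B (λ j → g (fsuc j)))
    tail = δ-⋁ x (λ j → g (fsuc j))

    to : δ x (⋁ B g) → ∃ λ β → δ x (g β)
    to d with Equivalence.to head∨tail d
    ... | inj₁ d′ = fzero , d′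
    ... | inj₂ d′ with Equivalence.to tail d′
    ...   | β , d″ = fsuc β , d″

    from : (∃ λ β → δ x (g β)) → δ x (⋁ B g)
    from (fzero  , d) = Equivalence.from head∨tail (inj₁ d)
    from (fsuc β , d) = Equivalence.from head∨tail (inj₂ (Equivalence.from tail (β , d)))

  module _ {N n} (f : Fin N → Fin n) (c̄ : Fin N → Carrier) where

    δ-* : ∀ x i → δ x (_* B f c̄ i) ⇔ ∃ λ β → f β ≡ i × δ x (c̄ β)
    δ-* x i = mk⇔ to from
      where
      to : δ x (_* B f c̄ i) → ∃ λ β → f β ≡ i × δ x (c̄ β)
      to d with Equivalence.to (δ-⋁ x _) d
      ... | β , d′ with f β ≟ i
      ...   | yes fβ≡i = β , fβ≡i , d′
      ...   | no  _    = ⊥-elim (δ-⊥ x (δ-sym d′))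

      from : (∃ λ β → f β ≡ i × δ x (c̄ β)) → δ x (_* B f c̄ i)
      from (β , fβ≡i , d) = Equivalence.from (δ-⋁ x _) (β , selected (f β ≟ i))
        where
        selected : ∀ q → δ x (if ⌊ q ⌋ then c̄ β else ⊥)
        selected (yes _)  = d
        selected (no f≢i) = ⊥-elim (f≢i fβ≡i)

    δ-*-* : ∀ i j → δ (_* B f c̄ i) (_* B f c̄ j) ⇔
            ∃₂ λ β β′ → f β ≡ i × f β′ ≡ j × δ (c̄ β) (c̄ β′)
    δ-*-* i j = mk⇔ to from
      where
      to : δ (_* B f c̄ i) (_* B f c̄ j) → ∃₂ λ β β′ → f β ≡ i × f β′ ≡ j × δ (c̄ β) (c̄ β′)
      to d with Equivalence.to (δ-* _ j) d
      ... | β′ , fβ′≡j , d′ with Equivalence.to (δ-* (c̄ β′) i) (δ-sym d′)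
      ...   | β , fβ≡i , d″ = β , β′ , fβ≡i , fβ′≡j , δ-sym d″

      from : (∃₂ λ β β′ → f β ≡ i × f β′ ≡ j × δ (c̄ β) (c̄ β′)) → δ (_* B f c̄ i) (_* B f c̄ j)
      from (β , β′ , fβ≡i , fβ′≡j , d) =
        δ-sym (Equivalence.from (δ-* _ i)
          (β , fβ≡i , δ-sym (Equivalence.from (δ-* (c̄ β) j) (β′ , fβ′≡j , d))))

  δ-self⇒⊤≉⊥ : ∀ y → δ y y → ¬ (⊤ ≈ ⊥)
  δ-self⇒⊤≉⊥ y d ⊤≈⊥ = δ-⊥ y (δ-resp y≈⊥ ≈-refl d)
    where
    y≈⊥ : y ≈ ⊥
    y≈⊥ = begin
      y     ≈⟨ ≈-sym (∧-identityʳ y) ⟩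
      y ∧ ⊤ ≈⟨ ∧-congˡ ⊤≈⊥ ⟩
      y ∧ ⊥ ≈⟨ ∧-zeroʳ y ⟩
      ⊥     ∎

  -- With one member it must be ⊤; with several, a zero member would lie
  -- strictly below any other one.
  𝒦-nonzero : ∀ {n} {a : Fin n → Carrier} → 𝒦 B n a → ¬ (⊤ ≈ ⊥) → ∀ i → ¬ (a i ≈ ⊥)
  𝒦-nonzero {suc zero} {a} K ⊤≉⊥ fzero a₀≈⊥ = ⊤≉⊥ (begin
    ⊤            ≈⟨ ≈-sym (𝒦.joinTop K) ⟩
    a fzero ∨ ⊥  ≈⟨ ∨-identityʳ _ ⟩
    a fzero      ≈⟨ a₀≈⊥ ⟩
    ⊥            ∎)
  𝒦-nonzero {suc (suc n)} {a} K _ i aᵢ≈⊥ = 𝒦.antichain K i (other i) (aᵢ≤aⱼ , aᵢ≉aⱼ)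
    where
    other : Fin (suc (suc n)) → Fin (suc (suc n))
    other fzero    = fsuc fzero
    other (fsuc _) = fzero

    i≢other : ∀ k → ¬ (k ≡ other k)
    i≢other fzero    ()
    i≢other (fsuc _) ()

    aᵢ≤aⱼ : (a i ∧ a (other i)) ≈ a i
    aᵢ≤aⱼ = begin
      a i ∧ a (other i) ≈⟨ ∧-congʳ aᵢ≈⊥ ⟩
      ⊥ ∧ a (other i)   ≈⟨ ∧-zeroˡ _ ⟩
      ⊥                 ≈⟨ ≈-sym aᵢ≈⊥ ⟩
      a i               ∎

    aᵢ≉aⱼ : ¬ (a i ≈ a (other i))
    aᵢ≉aⱼ e = i≢other i (𝒦.injective K i (other i) e)

  module _ {N} {c̄ : Fin N → Carrier} (chain : IsChain B c̄) where

    chain-consecutive : ∀ β β′ → Consecutive β β′ → δ (c̄ β) (c̄ β′)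
    chain-consecutive β β′ β′≡1+β =
      Equivalence.from (chain β β′) (subst
        (λ m → ∣ toℕ β - m ∣ ≤ 1) (sym β′≡1+β) (∣m-1+m∣≤1 (toℕ β)))

    chain-δ⇒≡⊎consecutive : ∀ β β′ → δ (c̄ β) (c̄ β′) →
                            β ≡ β′ ⊎ Consecutive β β′ ⊎ Consecutive β′ β
    chain-δ⇒≡⊎consecutive β β′ d
      with ∣m-n∣≤1⇒m≡n⊎adjacent (toℕ β) (toℕ β′) (Equivalence.to (chain β β′) d)
    ... | inj₁ eq = inj₁ (toℕ-injective eq)
    ... | inj₂ adjacent = inj₂ adjacent

lemma3p7 : ∀ {c ℓ r : Level} (B : ContactAlgebra c ℓ r) (N n : ℕ)
    (a : Fin n → ContactAlgebra.Carrier B) → 𝒦 B n a →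
    (f : Fin N → Fin n) → IsCoveringWalk (N¹ B a) N f →
    (c̄ : Fin N → ContactAlgebra.Carrier B) → 𝒦 B N c̄ → IsChain B c̄ →
    SameGraph B (N¹ B a) (N¹ B (_* B f c̄))
lemma3p7 B N n a Kₐ f walk c̄ _ chain i j = mk⇔ edge⇒contact contact⇒edge
  where
  open ContactAlgebra B using (δ; δ-sym; δ-refl)
  open IsCoveringWalk walk

  edge⇒contact : δ (a i) (a j) → δ (_* B f c̄ i) (_* B f c̄ j)
  edge⇒contact d with visitsEdges i j d
  ... | β , β′ , step , inj₁ (fβ≡i , fβ′≡j) =
    Equivalence.from (δ-*-* B f c̄ i j) (β , β′ , fβ≡i , fβ′≡j , chain-consecutive B chain β β′ step)
  ... | β , β′ , step , inj₂ (fβ≡j , fβ′≡i) =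
    Equivalence.from (δ-*-* B f c̄ i j) (β′ , β , fβ′≡i , fβ≡j , δ-sym (chain-consecutive B chain β β′ step))

  contact⇒edge : δ (_* B f c̄ i) (_* B f c̄ j) → δ (a i) (a j)
  contact⇒edge d with Equivalence.to (δ-*-* B f c̄ i j) d
  ... | β , β′ , refl , refl , d′ with chain-δ⇒≡⊎consecutive B chain β β′ d′
  ...   | inj₁ refl        = δ-refl (a (f β)) (𝒦-nonzero B Kₐ (δ-self⇒⊤≉⊥ B (c̄ β) d′) (f β))
  ...   | inj₂ (inj₁ step) = isWalk β β′ step
  ...   | inj₂ (inj₂ step) = δ-sym (isWalk β′ β step)
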